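{- Let $G=(V,E)$ be a graph and $X,Y\subseteq V$. Let $S\subseteq X$ be a shattered set, let $Z\subseteq V$ be a separator of $G$, and let $C_1,\dots,C_p$ be the connected components of $G-Z$. If there are distinct $i,j\in[p]$ with $S\cap V(C_i)\neq\emptyset$ and $S\cap V(C_j)\neq\emptyset$, then $|S|\le\log_2|Z|+2$.
   Context: $S\subseteq X$ is shattered if for every $S'\subseteq S$ there is $y\in Y$ with $N(y)\cap S=S'$, where $N(y)$ is the open neighborhood of $y$ in $G$. A separator is a set $Z\subseteq V$ such that $G-Z$ has at least two connected components. -}

module Defs where

open import Data.Nat using (ℕ)
open import Data.Bool using (Bool; true; false)
open import Data.Fin using (Fin)
open import Data.Fin.Subset using (Subset; _∈_; _∉_; _⊆_; _∩_)
open import Data.Vec using (tabulate)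
open import Data.Product using (Σ; ∃; _×_)
open import Relation.Binary.PropositionalEquality using (_≡_)
open import Relation.Nullary using (¬_)

record Graph (n : ℕ) : Set where
  field
    adj   : Fin n → Fin n → Bool
    sym   : ∀ u v → adj u v ≡ adj v u
    irrefl : ∀ v → adj v v ≡ false
open Graph public

N : ∀ {n} → Graph n → Fin n → Subset n
N G y = tabulate (adj G y)

Shattered : ∀ {n} → Graph n → (X Y S : Subset n) → Set
Shattered {n} G X Y S =
  S ⊆ X × (∀ (S' : Subset n) → S' ⊆ S → Σ (Fin n) λ y → y ∈ Y × (N G y ∩ S ≡ S'))

data Reach {n} (G : Graph n) (Z : Subset n) (u : Fin n) : Fin n → Set where
  here : u ∉ Z → Reach G Z u u
  step : ∀ {w v} → Reach G Z u w → adj G w v ≡ true → v ∉ Z → Reach G Z u v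

DiffComp : ∀ {n} → Graph n → Subset n → Fin n → Fin n → Set
DiffComp G Z u v = u ∉ Z × v ∉ Z × ¬ Reach G Z u v

Separator : ∀ {n} → Graph n → Subset n → Set
Separator G Z = ∃ λ u → ∃ λ v → DiffComp G Z u v

module Submission where

-- Let s, t ∈ S lie in different components of G − Z and put T = S ∖ {s, t}.
-- For every U ⊆ T the vertex y realising U ∪ {s, t} is a common neighbour of
-- s and t, so it cannot lie in G − Z: the neighbourhoods of vertices of Z
-- shatter T. A family shattering T has at least 2 ^ |T| members, and
-- |S| ≤ |T| + 2.

open import Defs hiding (sym)
open import Data.Nat using (ℕ; suc; _≤_; _+_; _*_; _^_; z≤n; s≤s)
open import Data.Nat.Properties
  using (≤-trans; ≤-reflexive; +-mono-≤; +-monoʳ-≤; +-monoˡ-≤; *-monoʳ-≤; +-suc; +-identityʳ;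
         *-assoc; n≤1+n; ^-monoʳ-≤; module ≤-Reasoning)
open import Data.Bool using (Bool; true; false)
open import Data.Fin using (Fin)
open import Data.Fin.Subset
  using (Subset; _∈_; _∉_; _⊆_; _∩_; _∪_; ∁; ⊥; ⁅_⁆; ∣_∣; inside; outside)
open import Data.Fin.Subset.Properties
  using (_∈?_; out⊆; in⊆in; ⊆-antisym; p∩q⊆p; x∈p∩q⁺; x∈p∪q⁺; x∈p∪q⁻;
         x∉p⇒x∈∁p; x∈⁅x⁆; x∈⁅y⁆⇒x≡y; ∣⁅x⁆∣≡1; ∣p∩q∣≤∣q∣; x∈p⇒∣p-x∣<∣p∣;
         p∩q⊆q; ∩-assoc; ∩-distribʳ-∪; ∩-inverseʳ; ∪-identityʳ)
open import Data.Vec using ([]; _∷_; head; tail; tabulate)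
open import Data.Vec.Properties using (∷-injective; ∷-injectiveʳ; lookup∘tabulate; []=⇒lookup; lookup⇒[]=)
open import Data.Product using (∃; _×_; _,_)
open import Data.Sum using (inj₁; inj₂)
open import Function using (_∘_)
open import Relation.Nullary using (yes; no; contradiction)
open import Relation.Binary.PropositionalEquality using (_≡_; refl; sym; trans; cong; cong₂; subst; module ≡-Reasoning)

private
  variable
    n m : ℕ

∣p∣≡∣p∩q∣+∣p∩∁q∣ : (p q : Subset n) → ∣ p ∣ ≡ ∣ p ∩ q ∣ + ∣ p ∩ ∁ q ∣
∣p∣≡∣p∩q∣+∣p∩∁q∣ []            []            = refl
∣p∣≡∣p∩q∣+∣p∩∁q∣ (inside  ∷ p) (inside  ∷ q) = cong suc (∣p∣≡∣p∩q∣+∣p∩∁q∣ p q)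
∣p∣≡∣p∩q∣+∣p∩∁q∣ (inside  ∷ p) (outside ∷ q) =
  trans (cong suc (∣p∣≡∣p∩q∣+∣p∩∁q∣ p q)) (sym (+-suc ∣ p ∩ q ∣ ∣ p ∩ ∁ q ∣))
∣p∣≡∣p∩q∣+∣p∩∁q∣ (outside ∷ p) (_       ∷ q) = ∣p∣≡∣p∩q∣+∣p∩∁q∣ p q

∣p∪q∣≤∣p∣+∣q∣ : (p q : Subset n) → ∣ p ∪ q ∣ ≤ ∣ p ∣ + ∣ q ∣
∣p∪q∣≤∣p∣+∣q∣ []            []            = z≤n
∣p∪q∣≤∣p∣+∣q∣ (inside  ∷ p) (inside  ∷ q) =
  s≤s (≤-trans (∣p∪q∣≤∣p∣+∣q∣ p q) (+-monoʳ-≤ ∣ p ∣ (n≤1+n ∣ q ∣)))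
∣p∪q∣≤∣p∣+∣q∣ (inside  ∷ p) (outside ∷ q) = s≤s (∣p∪q∣≤∣p∣+∣q∣ p q)
∣p∪q∣≤∣p∣+∣q∣ (outside ∷ p) (inside  ∷ q) rewrite +-suc ∣ p ∣ ∣ q ∣ = s≤s (∣p∪q∣≤∣p∣+∣q∣ p q)
∣p∪q∣≤∣p∣+∣q∣ (outside ∷ p) (outside ∷ q) = ∣p∪q∣≤∣p∣+∣q∣ p q

∣⁅x⁆∪⁅y⁆∣≤2 : (x y : Fin n) → ∣ ⁅ x ⁆ ∪ ⁅ y ⁆ ∣ ≤ 2
∣⁅x⁆∪⁅y⁆∣≤2 x y =
  ≤-trans (∣p∪q∣≤∣p∣+∣q∣ ⁅ x ⁆ ⁅ y ⁆) (≤-reflexive (cong₂ _+_ (∣⁅x⁆∣≡1 x) (∣⁅x⁆∣≡1 y)))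

p⊆q⇒p∩q≡p : {p q : Subset n} → p ⊆ q → p ∩ q ≡ p
p⊆q⇒p∩q≡p {p = p} {q} p⊆q = ⊆-antisym (p∩q⊆p p q) (λ x∈p → x∈p∩q⁺ (x∈p , p⊆q x∈p))

∪-lub : {p q r : Subset n} → p ⊆ r → q ⊆ r → p ∪ q ⊆ r
∪-lub {p = p} {q} p⊆r q⊆r x∈p∪q with x∈p∪q⁻ p q x∈p∪q
... | inj₁ x∈p = p⊆r x∈p
... | inj₂ x∈q = q⊆r x∈q

⁅x⁆⊆p : {x : Fin n} {p : Subset n} → x ∈ p → ⁅ x ⁆ ⊆ p
⁅x⁆⊆p {x = x} {p} x∈p y∈⁅x⁆ = subst (_∈ p) (sym (x∈⁅y⁆⇒x≡y x y∈⁅x⁆)) x∈p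

∩∁-cancel-∪ : (p q u r : Subset n) → p ∩ q ≡ u ∪ r → u ⊆ ∁ r → p ∩ (q ∩ ∁ r) ≡ u
∩∁-cancel-∪ p q u r p∩q≡u∪r u⊆∁r = begin
  p ∩ (q ∩ ∁ r)          ≡⟨ sym (∩-assoc p q (∁ r)) ⟩
  (p ∩ q) ∩ ∁ r          ≡⟨ cong (_∩ ∁ r) p∩q≡u∪r ⟩
  (u ∪ r) ∩ ∁ r          ≡⟨ ∩-distribʳ-∪ (∁ r) u r ⟩
  u ∩ ∁ r ∪ r ∩ ∁ r      ≡⟨ cong (u ∩ ∁ r ∪_) (∩-inverseʳ r) ⟩
  u ∩ ∁ r ∪ ⊥            ≡⟨ ∪-identityʳ (u ∩ ∁ r) ⟩
  u ∩ ∁ r                ≡⟨ p⊆q⇒p∩q≡p u⊆∁r ⟩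
  u                      ∎
  where open ≡-Reasoning

∈-tabulate⁺ : {f : Fin n → Bool} {x : Fin n} → f x ≡ true → x ∈ tabulate f
∈-tabulate⁺ {f = f} {x} fx≡true = lookup⇒[]= x (tabulate f) (trans (lookup∘tabulate f x) fx≡true)

∈-tabulate⁻ : {f : Fin n → Bool} {x : Fin n} → x ∈ tabulate f → f x ≡ true
∈-tabulate⁻ {f = f} {x} x∈f = trans (sym (lookup∘tabulate f x)) ([]=⇒lookup x∈f)

∉-tabulate⁺ : {f : Fin n → Bool} {x : Fin n} → f x ≡ false → x ∉ tabulate f
∉-tabulate⁺ fx≡false x∈f with trans (sym fx≡false) (∈-tabulate⁻ x∈f)
... | ()

Shatters : (Fin n → Subset m) → Subset n → Subset m → Set
Shatters R Z T = ∀ U → U ⊆ T → ∃ λ y → y ∈ Z × R y ∩ T ≡ U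

∩-inside∷⁻ : (p : Subset (suc m)) {q u : Subset m} {c : Bool} →
             p ∩ (inside ∷ q) ≡ c ∷ u → head p ≡ c × tail p ∩ q ≡ u
∩-inside∷⁻ (inside  ∷ p) = ∷-injective
∩-inside∷⁻ (outside ∷ p) = ∷-injective

∩-∷⁻ʳ : (p : Subset (suc m)) {q u : Subset m} {b c : Bool} →
        p ∩ (b ∷ q) ≡ c ∷ u → tail p ∩ q ≡ u
∩-∷⁻ʳ (_ ∷ p) = ∷-injectiveʳ

-- Induction on T: splitting Z according to whether R y contains the first
-- point of T, each half still shatters the remaining points.
Shatters⇒2^∣T∣≤∣Z∣ : (R : Fin n → Subset m) (Z : Subset n) (T : Subset m) →
                     Shatters R Z T → 2 ^ ∣ T ∣ ≤ ∣ Z ∣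
Shatters⇒2^∣T∣≤∣Z∣ R Z [] shatters with shatters [] (λ ())
... | y , y∈Z , _ = ≤-trans (s≤s z≤n) (x∈p⇒∣p-x∣<∣p∣ y∈Z)
Shatters⇒2^∣T∣≤∣Z∣ R Z (outside ∷ T) shatters =
  Shatters⇒2^∣T∣≤∣Z∣ (tail ∘ R) Z T shatters-tail
  where
  shatters-tail : Shatters (tail ∘ R) Z T
  shatters-tail U U⊆T with shatters (outside ∷ U) (out⊆ U⊆T)
  ... | y , y∈Z , eq = y , y∈Z , ∩-∷⁻ʳ (R y) eq
Shatters⇒2^∣T∣≤∣Z∣ R Z (inside ∷ T) shatters = begin
  2 ^ ∣ T ∣ + (2 ^ ∣ T ∣ + 0) ≡⟨ cong (2 ^ ∣ T ∣ +_) (+-identityʳ (2 ^ ∣ T ∣)) ⟩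
  2 ^ ∣ T ∣ + 2 ^ ∣ T ∣       ≤⟨ +-mono-≤ (Shatters⇒2^∣T∣≤∣Z∣ (tail ∘ R) (Z ∩ H) T shatters-H)
                                          (Shatters⇒2^∣T∣≤∣Z∣ (tail ∘ R) (Z ∩ ∁ H) T shatters-∁H) ⟩
  ∣ Z ∩ H ∣ + ∣ Z ∩ ∁ H ∣     ≡⟨ sym (∣p∣≡∣p∩q∣+∣p∩∁q∣ Z H) ⟩
  ∣ Z ∣                       ∎
  where
  open ≤-Reasoning
  H : Subset _
  H = tabulate (head ∘ R)
  shatters-H : Shatters (tail ∘ R) (Z ∩ H) T
  shatters-H U U⊆T with shatters (inside ∷ U) (in⊆in U⊆T)
  ... | y , y∈Z , eq with ∩-inside∷⁻ (R y) eq
  ...   | y∈H , eq′ = y , x∈p∩q⁺ (y∈Z , ∈-tabulate⁺ y∈H) , eq′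
  shatters-∁H : Shatters (tail ∘ R) (Z ∩ ∁ H) T
  shatters-∁H U U⊆T with shatters (outside ∷ U) (out⊆ U⊆T)
  ... | y , y∈Z , eq with ∩-inside∷⁻ (R y) eq
  ...   | y∉H , eq′ = y , x∈p∩q⁺ (y∈Z , x∉p⇒x∈∁p (∉-tabulate⁺ y∉H)) , eq′

common-neighbour∈Z : (G : Graph n) (Z : Subset n) {s t y : Fin n} →
                     DiffComp G Z s t → s ∈ N G y → t ∈ N G y → y ∈ Z
common-neighbour∈Z G Z {s} {t} {y} (s∉Z , t∉Z , ¬s⇝t) s∈Ny t∈Ny with y ∈? Z
... | yes y∈Z = y∈Z
... | no  y∉Z = contradiction (step (step (here s∉Z) s~y y∉Z) (∈-tabulate⁻ t∈Ny) t∉Z) ¬s⇝t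
  where
  s~y : adj G s y ≡ true
  s~y = trans (Graph.sym G s y) (∈-tabulate⁻ s∈Ny)

separated-pair⇒Shatters : (G : Graph n) (X Y S Z : Subset n) {s t : Fin n} →
                          Shattered G X Y S → DiffComp G Z s t → s ∈ S → t ∈ S →
                          Shatters (N G) Z (S ∩ ∁ (⁅ s ⁆ ∪ ⁅ t ⁆))
separated-pair⇒Shatters G X Y S Z {s} {t} (_ , shattered) s|t s∈S t∈S U U⊆T =
  trace (shattered (U ∪ Q) (∪-lub (p∩q⊆p S (∁ Q) ∘ U⊆T) (∪-lub (⁅x⁆⊆p s∈S) (⁅x⁆⊆p t∈S))))
  where
  Q : Subset _
  Q = ⁅ s ⁆ ∪ ⁅ t ⁆
  trace : (∃ λ y → y ∈ Y × N G y ∩ S ≡ U ∪ Q) → ∃ λ y → y ∈ Z × N G y ∩ (S ∩ ∁ Q) ≡ U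
  trace (y , _ , Ny∩S≡U∪Q) =
    y , common-neighbour∈Z G Z s|t (∈Ny (x∈p∪q⁺ (inj₁ (x∈⁅x⁆ s)))) (∈Ny (x∈p∪q⁺ (inj₂ (x∈⁅x⁆ t))))
      , ∩∁-cancel-∪ (N G y) S U Q Ny∩S≡U∪Q (p∩q⊆q S (∁ Q) ∘ U⊆T)
    where
    ∈Ny : {x : Fin _} → x ∈ Q → x ∈ N G y
    ∈Ny x∈Q = p∩q⊆p (N G y) S (subst (_ ∈_) (sym Ny∩S≡U∪Q) (x∈p∪q⁺ (inj₂ x∈Q)))

lemma5 : ∀ {n} (G : Graph n) (X Y S Z : Subset n)
         → Shattered G X Y S
         → Separator G Z
         → (∃ λ s → ∃ λ t → s ∈ S × t ∈ S × DiffComp G Z s t)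
         → 2 ^ ∣ S ∣ ≤ 4 * ∣ Z ∣
-- The separator hypothesis is implied by the separated pair s, t.
lemma5 G X Y S Z shattered _ (s , t , s∈S , t∈S , s|t) = begin
  2 ^ ∣ S ∣           ≤⟨ ^-monoʳ-≤ 2 ∣S∣≤2+∣T∣ ⟩
  2 * (2 * 2 ^ ∣ T ∣) ≡⟨ sym (*-assoc 2 2 (2 ^ ∣ T ∣)) ⟩
  4 * 2 ^ ∣ T ∣       ≤⟨ *-monoʳ-≤ 4 (Shatters⇒2^∣T∣≤∣Z∣ (N G) Z T
                            (separated-pair⇒Shatters G X Y S Z shattered s|t s∈S t∈S)) ⟩
  4 * ∣ Z ∣           ∎
  where
  open ≤-Reasoning
  Q T : Subset _
  Q = ⁅ s ⁆ ∪ ⁅ t ⁆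
  T = S ∩ ∁ Q
  ∣S∣≤2+∣T∣ : ∣ S ∣ ≤ 2 + ∣ T ∣
  ∣S∣≤2+∣T∣ = begin
    ∣ S ∣             ≡⟨ ∣p∣≡∣p∩q∣+∣p∩∁q∣ S Q ⟩
    ∣ S ∩ Q ∣ + ∣ T ∣ ≤⟨ +-monoˡ-≤ ∣ T ∣ (≤-trans (∣p∩q∣≤∣q∣ S Q) (∣⁅x⁆∪⁅y⁆∣≤2 s t)) ⟩
    2 + ∣ T ∣         ∎
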